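{- For all finite sets $\Gamma_1,\Gamma_2$ of formulas and finite multisets $\Delta_1,\Delta_2$ of formulas: $(\Gamma_1;\Delta_1)\preceq_l(\Gamma_2;\Delta_2)$ if and only if $(\Gamma_1;\Delta_1)\preceq_s(\Gamma_2;\Delta_2)$.
   Context: Formulas: $A,B,C ::= a \mid \mathbf{1} \mid A\otimes B \mid \top \mid A \,\&\, B \mid a \multimap B \mid\ !A$, with $a$ ranging over atomic formulas. Contexts $\Gamma,\Delta$ are finite multisets of formulas; "$\Delta_1,\Delta_2$" is multiset union, "$\cdot$" the empty context. Sequents $\Gamma;\Delta\vdash A$ are derivable by the rules: (init) $\Gamma;a\vdash a$. (clone) from $\Gamma,A;\Delta,A\vdash C$ infer $\Gamma,A;\Delta\vdash C$. ($\otimes$R) from $\Gamma;\Delta_1\vdash A$ and $\Gamma;\Delta_2\vdash B$ infer $\Gamma;\Delta_1,\Delta_2\vdash A\otimes B$. ($\otimes$L) from $\Gamma;\Delta,A,B\vdash C$ infer $\Gamma;\Delta,A\otimes B\vdash C$. ($\mathbf 1$R) $\Gamma;\cdot\vdash\mathbf 1$. ($\mathbf 1$L) from $\Gamma;\Delta\vdash C$ infer $\Gamma;\Delta,\mathbf 1\vdash C$. ($\&$R) from $\Gamma;\Delta\vdash A$ and $\Gamma;\Delta\vdash B$ infer $\Gamma;\Delta\vdash A\&B$. ($\&$L$_i$, $i=1,2$) from $\Gamma;\Delta,A_i\vdash C$ infer $\Gamma;\Delta,A_1\&A_2\vdash C$. ($\top$R) $\Gamma;\Delta\vdash\top$ (no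 left rule for $\top$). ($\multimap$R) from $\Gamma;\Delta,a\vdash B$ infer $\Gamma;\Delta\vdash a\multimap B$. ($\multimap$L) from $\Gamma;\Delta_1\vdash a$ and $\Gamma;\Delta_2,B\vdash C$ infer $\Gamma;\Delta_1,\Delta_2,a\multimap B\vdash C$. (!R) from $\Gamma;\cdot\vdash A$ infer $\Gamma;\cdot\vdash\,!A$. (!L) from $\Gamma,A;\Delta\vdash C$ infer $\Gamma;\Delta,!A\vdash C$. Logical preorder: $(\Gamma_1;\Delta_1)\preceq_l(\Gamma_2;\Delta_2)$ iff for all contexts $\Gamma',\Delta'$ and all formulas $C$, derivability of $\Gamma',\Gamma_1;\Delta',\Delta_1\vdash C$ implies derivability of $\Gamma',\Gamma_2;\Delta',\Delta_2\vdash C$. States are pairs $(\Gamma;\Delta)$ modulo structural congruence $\equiv$: $\Delta$ is a multiset and $\Gamma$ a set ($(\Gamma,A,A;\Delta)\equiv(\Gamma,A;\Delta)$); congruent states are identified. Composition: $((\Gamma_1;\Delta_1),(\Gamma_2;\Delta_2)) := (\Gamma_1,\Gamma_2;\Delta_1,\Delta_2)$. Labelled transitions with labels $\tau$, $!a$, $?a$ ($a$ atomic) are generated by: $(\Gamma;\Delta,a)\xrightarrow{!a}(\Gamma;\Delta)$; $(\Gamma;\Delta,a\multimap B)\xrightarrow{?a}(\Gamma;\Delta,B)$; if $S_1\xrightarrow{!a}S_1'$ and $S_2\xrightarrow{?a}S_2'$ then $(S_1,S_2)\xrightarrow{\tau}(S_1',S_2')$; $(\Gamma;\Delta,A\otimes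 B)\xrightarrow{\tau}(\Gamma;\Delta,A,B)$; $(\Gamma;\Delta,\mathbf 1)\xrightarrow{\tau}(\Gamma;\Delta)$; $(\Gamma;\Delta,A_1\&A_2)\xrightarrow{\tau}(\Gamma;\Delta,A_i)$; $(\Gamma;\Delta,!A)\xrightarrow{\tau}(\Gamma,A;\Delta)$; $(\Gamma,A;\Delta)\xrightarrow{\tau}(\Gamma,A;\Delta,A)$ (no rule for $\top$). $\alpha$ ranges over $\tau$ and $!a$. $\overset{\tau}{\Longrightarrow}$ is the reflexive transitive closure of $\xrightarrow{\tau}$; for $\beta\ne\tau$, $\overset{\beta}{\Longrightarrow}$ is $\overset{\tau}{\Longrightarrow}\xrightarrow{\beta}\overset{\tau}{\Longrightarrow}$. A relation $\mathcal R$ on states is a simulation if $(\Gamma_1;\Delta_1)\mathcal R(\Gamma_2;\Delta_2)$ implies: (1) if $(\Gamma_1;\Delta_1)\equiv(\Gamma_1';\cdot)$ then $(\Gamma_2;\Delta_2)\overset{\tau}{\Longrightarrow}(\Gamma_2';\cdot)$ with $(\Gamma_1';\cdot)\mathcal R(\Gamma_2';\cdot)$; (2) if $(\Gamma_1;\Delta_1)\equiv((\Gamma_1';\Delta_1'),(\Gamma_1'';\Delta_1''))$ then $(\Gamma_2;\Delta_2)\overset{\tau}{\Longrightarrow}((\Gamma_2';\Delta_2'),(\Gamma_2'';\Delta_2''))$ with $(\Gamma_1';\Delta_1')\mathcal R(\Gamma_2';\Delta_2')$ and $(\Gamma_1'';\Delta_1'')\mathcal R(\Gamma_2'';\Delta_2'')$;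 (3) if $(\Gamma_1;\Delta_1)\xrightarrow{\alpha}(\Gamma_1';\Delta_1')$ then $(\Gamma_2;\Delta_2)\overset{\alpha}{\Longrightarrow}(\Gamma_2';\Delta_2')$ with $(\Gamma_1';\Delta_1')\mathcal R(\Gamma_2';\Delta_2')$; (4) if $(\Gamma_1;\Delta_1)\xrightarrow{?a}(\Gamma_1';\Delta_1')$ then $(\Gamma_2;\Delta_2,a)\overset{\tau}{\Longrightarrow}(\Gamma_2';\Delta_2')$ with $(\Gamma_1';\Delta_1')\mathcal R(\Gamma_2';\Delta_2')$. $S_1\preceq_s S_2$ iff some simulation relates $S_1$ to $S_2$. -}

module Defs where

open import Level using (Level; 0ℓ) renaming (suc to lsuc)
open import Data.Nat using (ℕ)
open import Data.List using (List; []; _∷_; _++_)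
open import Data.List.Membership.Propositional using (_∈_)
open import Data.List.Relation.Binary.Permutation.Propositional using (_↭_)
open import Data.List.Relation.Unary.Unique.Propositional using (Unique)
open import Data.Product using (Σ; _×_; _,_; proj₁; proj₂)
open import Relation.Binary.Construct.Closure.ReflexiveTransitive using (Star)

Atom : Set
Atom = ℕ

infixr 6 _⊗_
infixr 6 _&_
infixr 5 _⊸_

data Formula : Set where
  atom : Atom → Formula
  𝟏    : Formula
  _⊗_  : Formula → Formula → Formula
  ⊤'   : Formula
  _&_  : Formula → Formula → Formula
  _⊸_  : Atom → Formula → Formula
  !_   : Formula → Formula

-- Contexts: finite multisets, represented as lists; the rule `exch`
-- closes derivability under permutation of both contexts, so sequents
-- only depend on the underlying multisets.
Ctx : Set
Ctx = List Formula

infix 3 _⨾_⊢_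

data _⨾_⊢_ : Ctx → Ctx → Formula → Set where
  exch  : ∀ {Γ Γ' Δ Δ' C} → Γ ↭ Γ' → Δ ↭ Δ' → Γ ⨾ Δ ⊢ C → Γ' ⨾ Δ' ⊢ C
  init  : ∀ {Γ a} → Γ ⨾ atom a ∷ [] ⊢ atom a
  clone : ∀ {Γ Δ A C} → (A ∷ Γ) ⨾ (A ∷ Δ) ⊢ C → (A ∷ Γ) ⨾ Δ ⊢ C
  ⊗R    : ∀ {Γ Δ₁ Δ₂ A B} → Γ ⨾ Δ₁ ⊢ A → Γ ⨾ Δ₂ ⊢ B → Γ ⨾ Δ₁ ++ Δ₂ ⊢ A ⊗ B
  ⊗L    : ∀ {Γ Δ A B C} → Γ ⨾ A ∷ B ∷ Δ ⊢ C → Γ ⨾ (A ⊗ B) ∷ Δ ⊢ C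
  𝟏R    : ∀ {Γ} → Γ ⨾ [] ⊢ 𝟏
  𝟏L    : ∀ {Γ Δ C} → Γ ⨾ Δ ⊢ C → Γ ⨾ 𝟏 ∷ Δ ⊢ C
  &R    : ∀ {Γ Δ A B} → Γ ⨾ Δ ⊢ A → Γ ⨾ Δ ⊢ B → Γ ⨾ Δ ⊢ A & B
  &L₁   : ∀ {Γ Δ A B C} → Γ ⨾ A ∷ Δ ⊢ C → Γ ⨾ (A & B) ∷ Δ ⊢ C
  &L₂   : ∀ {Γ Δ A B C} → Γ ⨾ B ∷ Δ ⊢ C → Γ ⨾ (A & B) ∷ Δ ⊢ C
  ⊤R    : ∀ {Γ Δ} → Γ ⨾ Δ ⊢ ⊤'
  ⊸R    : ∀ {Γ Δ a B} → Γ ⨾ atom a ∷ Δ ⊢ B → Γ ⨾ Δ ⊢ a ⊸ B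
  ⊸L    : ∀ {Γ Δ₁ Δ₂ a B C} → Γ ⨾ Δ₁ ⊢ atom a → Γ ⨾ B ∷ Δ₂ ⊢ C →
          Γ ⨾ (a ⊸ B) ∷ (Δ₁ ++ Δ₂) ⊢ C
  !R    : ∀ {Γ A} → Γ ⨾ [] ⊢ A → Γ ⨾ [] ⊢ ! A
  !L    : ∀ {Γ Δ A C} → (A ∷ Γ) ⨾ Δ ⊢ C → Γ ⨾ (! A) ∷ Δ ⊢ C

State : Set
State = Ctx × Ctx

_≼l_ : State → State → Set
(Γ₁ , Δ₁) ≼l (Γ₂ , Δ₂) =
  ∀ (Γ' Δ' : Ctx) (C : Formula) →
    (Γ' ++ Γ₁) ⨾ (Δ' ++ Δ₁) ⊢ C → (Γ' ++ Γ₂) ⨾ (Δ' ++ Δ₂) ⊢ C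

_≈Set_ : Ctx → Ctx → Set
Γ ≈Set Γ' = (∀ x → x ∈ Γ → x ∈ Γ') × (∀ x → x ∈ Γ' → x ∈ Γ)

_≅_ : State → State → Set
(Γ , Δ) ≅ (Γ' , Δ') = (Γ ≈Set Γ') × (Δ ↭ Δ')

_⊕_ : State → State → State
(Γ₁ , Δ₁) ⊕ (Γ₂ , Δ₂) = (Γ₁ ++ Γ₂ , Δ₁ ++ Δ₂)

-- Labels τ, !a (snd a), ?a (rcv a)
data Label : Set where
  τ   : Label
  snd : Atom → Label
  rcv : Atom → Label

data _-[_]→_ : State → Label → State → Set where
  cong : ∀ {S S' T' T l} → S ≅ S' → S' -[ l ]→ T' → T' ≅ T → S -[ l ]→ T
  out  : ∀ {Γ Δ a} → (Γ , atom a ∷ Δ) -[ snd a ]→ (Γ , Δ)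
  inp  : ∀ {Γ Δ a B} → (Γ , (a ⊸ B) ∷ Δ) -[ rcv a ]→ (Γ , B ∷ Δ)
  com  : ∀ {S₁ S₁' S₂ S₂' a} → S₁ -[ snd a ]→ S₁' → S₂ -[ rcv a ]→ S₂' →
         (S₁ ⊕ S₂) -[ τ ]→ (S₁' ⊕ S₂')
  ten  : ∀ {Γ Δ A B} → (Γ , (A ⊗ B) ∷ Δ) -[ τ ]→ (Γ , A ∷ B ∷ Δ)
  one  : ∀ {Γ Δ} → (Γ , 𝟏 ∷ Δ) -[ τ ]→ (Γ , Δ)
  with₁ : ∀ {Γ Δ A B} → (Γ , (A & B) ∷ Δ) -[ τ ]→ (Γ , A ∷ Δ)
  with₂ : ∀ {Γ Δ A B} → (Γ , (A & B) ∷ Δ) -[ τ ]→ (Γ , B ∷ Δ)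
  bang : ∀ {Γ Δ A} → (Γ , (! A) ∷ Δ) -[ τ ]→ (A ∷ Γ , Δ)
  copy : ∀ {Γ Δ A} → A ∈ Γ → (Γ , Δ) -[ τ ]→ (Γ , A ∷ Δ)

_-τ→_ : State → State → Set
S -τ→ T = S -[ τ ]→ T

_⟹τ_ : State → State → Set
S ⟹τ T = Σ State λ U → Star _-τ→_ S U × U ≅ T

_⟹[_]_ : State → Label → State → Set
S ⟹[ β ] T = Σ State λ U → Σ State λ V → S ⟹τ U × U -[ β ]→ V × V ⟹τ T

-- Simulation (as a relation on ≅-classes: required to respect ≅)
record IsSimulation (R : State → State → Set) : Set where
  field
    resp : ∀ {S S' T T'} → S ≅ S' → T ≅ T' → R S T → R S' T'
    c1 : ∀ {S₁ S₂} → R S₁ S₂ → ∀ Γ₁' → S₁ ≅ (Γ₁' , []) →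
         Σ Ctx λ Γ₂' → S₂ ⟹τ (Γ₂' , []) × R (Γ₁' , []) (Γ₂' , [])
    c2 : ∀ {S₁ S₂} → R S₁ S₂ → ∀ S₁' S₁'' → S₁ ≅ (S₁' ⊕ S₁'') →
         Σ State λ S₂' → Σ State λ S₂'' →
           S₂ ⟹τ (S₂' ⊕ S₂'') × R S₁' S₂' × R S₁'' S₂''
    c3τ : ∀ {S₁ S₂} → R S₁ S₂ → ∀ S₁' → S₁ -[ τ ]→ S₁' →
          Σ State λ S₂' → S₂ ⟹τ S₂' × R S₁' S₂'
    c3! : ∀ {S₁ S₂} → R S₁ S₂ → ∀ a S₁' → S₁ -[ snd a ]→ S₁' →
          Σ State λ S₂' → S₂ ⟹[ snd a ] S₂' × R S₁' S₂'
    c4 : ∀ {S₁ S₂} → R S₁ S₂ → ∀ a S₁' → S₁ -[ rcv a ]→ S₁' →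
         Σ State λ S₂' → (proj₁ S₂ , atom a ∷ proj₂ S₂) ⟹τ S₂' × R S₁' S₂'

_≼s_ : State → State → Set₁
S ≼s T = Σ (State → State → Set) λ R → IsSimulation R × R S T

-- Both preorders are compared through a satisfaction relation S ⊩ C defined by
-- recursion on C from weak τ-runs; in particular S ⊩ a ⊸ B means that S in
-- parallel with the atom a satisfies B.  A state (Γ ; Δ) satisfies C exactly when
-- Γ ; Δ ⊢ C is derivable: left rules are τ-steps read backwards.
-- A simulation stays one when a common context is put in parallel on both sides,
-- and then preserves ⊩ by induction on C; taking Γ' ; Δ' as that context gives
-- ≼s ⊆ ≼l.  Conversely, "T satisfies the characteristic formula !(&Γ) ⊗ (⊗Δ) of
-- S = (Γ ; Δ)" is a simulation, and it contains ≼l because S satisfies its own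
-- characteristic formula.

module Submission where

open import Defs
open import Data.List.Relation.Unary.Unique.Propositional using (Unique)
open import Data.Product using (_×_; _,_)

open import Function using (_∘_)
open import Data.Nat as ℕ using (ℕ)
open import Data.Unit using (⊤; tt)
open import Data.Sum using (_⊎_; inj₁; inj₂; [_,_])
open import Data.Product using (∃; ∃₂; proj₁; proj₂; uncurry)
open import Data.List using ([]; _∷_; _++_; filter)
import Data.List.Properties as List
open import Data.List.Relation.Unary.Any using (here; there)
open import Data.List.Membership.Propositional using (_∈_)
open import Data.List.Membership.Propositional.Properties
  using (∈-++⁺ˡ; ∈-++⁺ʳ; ∈-++⁻; ∈-∃++; ∈-filter⁺; ∈-filter⁻)
open import Data.List.Relation.Binary.Subset.Propositional using (_⊆_)
open import Data.List.Relation.Binary.Subset.Propositional.Properties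
  using (⊆-refl; xs⊆xs++ys; xs⊆ys++xs; ∈-∷⁺ʳ)
  renaming (++⁺ to ⊆-++⁺)
import Data.List.Relation.Binary.Permutation.Propositional as Perm
open Perm using (_↭_; ↭-refl; ↭-sym; ↭-trans; prep)
open import Data.List.Relation.Binary.Permutation.Propositional.Properties
  using (∈-resp-↭; shift; drop-∷; ++⁺ˡ; ++⁺ʳ; ++⁺; ++-comm; ↭-empty-inv)
open import Relation.Binary.PropositionalEquality using (_≡_; refl; cong₂)
  renaming (cong to ≡-cong)
open import Relation.Binary.Construct.Closure.ReflexiveTransitive using (Star; ε; _◅_; _◅◅_)
open import Relation.Binary.Definitions using (DecidableEquality)
open import Relation.Nullary using (Dec; yes; no)
open import Relation.Nullary.Decidable using (map′; _×-dec_)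

-- Structural congruence

++-⊆ : ∀ {xs ys zs : Ctx} → xs ⊆ zs → ys ⊆ zs → (xs ++ ys) ⊆ zs
++-⊆ {xs} p q m = [ p , q ] (∈-++⁻ xs m)

≈Set-intro : ∀ {Γ Γ'} → Γ ⊆ Γ' → Γ' ⊆ Γ → Γ ≈Set Γ'
≈Set-intro p q = (λ _ → p) , (λ _ → q)

≈Set-refl : ∀ {Γ} → Γ ≈Set Γ
≈Set-refl = ≈Set-intro ⊆-refl ⊆-refl

≅-refl : ∀ {S} → S ≅ S
≅-refl = ≈Set-refl , ↭-refl

≅-sym : ∀ {S T} → S ≅ T → T ≅ S
≅-sym ((p , q) , r) = (q , p) , ↭-sym r

≅-trans : ∀ {S T U} → S ≅ T → T ≅ U → S ≅ U
≅-trans ((p , q) , r) ((p' , q') , r') =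
  ≈Set-intro (λ m → p' _ (p _ m)) (λ m → q _ (q' _ m)) , ↭-trans r r'

≅-reflexive : ∀ {S T} → S ≡ T → S ≅ T
≅-reflexive refl = ≅-refl

⊕-cong : ∀ {S S' T T'} → S ≅ S' → T ≅ T' → (S ⊕ T) ≅ (S' ⊕ T')
⊕-cong ((p , q) , r) ((p' , q') , r') =
  ≈Set-intro (⊆-++⁺ (p _) (p' _)) (⊆-++⁺ (q _) (q' _)) , ++⁺ r r'

⊕-congˡ : ∀ {S S'} T → S ≅ S' → (S ⊕ T) ≅ (S' ⊕ T)
⊕-congˡ T e = ⊕-cong e ≅-refl

⊕-congʳ : ∀ S {T T'} → T ≅ T' → (S ⊕ T) ≅ (S ⊕ T')
⊕-congʳ S e = ⊕-cong ≅-refl e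

⊕-comm : ∀ S T → (S ⊕ T) ≅ (T ⊕ S)
⊕-comm (Γ , Δ) (Γ' , Δ') =
  ≈Set-intro (++-⊆ (xs⊆ys++xs Γ Γ') (xs⊆xs++ys Γ' Γ))
             (++-⊆ (xs⊆ys++xs Γ' Γ) (xs⊆xs++ys Γ Γ')) ,
  ++-comm Δ Δ'

⊕-assoc : ∀ S T U → ((S ⊕ T) ⊕ U) ≅ (S ⊕ (T ⊕ U))
⊕-assoc (Γ , Δ) (Γ' , Δ') (Γ'' , Δ'') =
  ≅-reflexive (cong₂ _,_ (List.++-assoc Γ Γ' Γ'') (List.++-assoc Δ Δ' Δ''))

⊕-identityʳ : ∀ S → (S ⊕ ([] , [])) ≅ S
⊕-identityʳ (Γ , Δ) =
  ≅-reflexive (cong₂ _,_ (List.++-identityʳ Γ) (List.++-identityʳ Δ))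

⊕-lcomm : ∀ S T U → (S ⊕ (T ⊕ U)) ≅ (T ⊕ (S ⊕ U))
⊕-lcomm S T U =
  ≅-trans (≅-sym (⊕-assoc S T U))
    (≅-trans (⊕-congˡ U (⊕-comm S T)) (⊕-assoc T S U))

⊕-interchange : ∀ S T U V → ((S ⊕ T) ⊕ (U ⊕ V)) ≅ ((S ⊕ U) ⊕ (T ⊕ V))
⊕-interchange S T U V =
  ≅-trans (⊕-assoc S T (U ⊕ V))
    (≅-trans (⊕-congʳ S (⊕-lcomm T U V)) (≅-sym (⊕-assoc S U (T ⊕ V))))

⊕-pushˡ : ∀ P U S {Z} → Z ≅ (U ⊕ S) → (P ⊕ Z) ≅ ((P ⊕ U) ⊕ S)
⊕-pushˡ P U S e = ≅-trans (⊕-congʳ P e) (≅-sym (⊕-assoc P U S))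

⊕-pushʳ : ∀ P U S {Z} → Z ≅ (U ⊕ S) → (P ⊕ Z) ≅ (U ⊕ (P ⊕ S))
⊕-pushʳ P U S e = ≅-trans (⊕-congʳ P e) (⊕-lcomm P U S)

≅-share : ∀ Γ Δ₁ Δ₂ → (Γ , Δ₁ ++ Δ₂) ≅ ((Γ , Δ₁) ⊕ (Γ , Δ₂))
≅-share Γ Δ₁ Δ₂ = ≈Set-intro (xs⊆xs++ys Γ Γ) (++-⊆ ⊆-refl ⊆-refl) , ↭-refl

≅-absorb : ∀ {G Γ} Δ → Γ ⊆ G → (G , Δ) ≅ ((G , []) ⊕ (Γ , Δ))
≅-absorb {G} {Γ} Δ s = ≈Set-intro (xs⊆xs++ys G Γ) (++-⊆ ⊆-refl s) , ↭-refl

⊕-distrib-persistent : ∀ G S T →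
  ((G , []) ⊕ (S ⊕ T)) ≅ (((G , []) ⊕ S) ⊕ ((G , []) ⊕ T))
⊕-distrib-persistent G S T =
  ≅-trans (⊕-congˡ (S ⊕ T) (≅-share G [] [])) (⊕-interchange (G , []) (G , []) S T)

∈⇒↭∷ : ∀ {x : Formula} {Δ} → x ∈ Δ → ∃ λ Δ' → Δ ↭ (x ∷ Δ')
∈⇒↭∷ {x} m with ∈-∃++ m
... | ys , zs , refl = ys ++ zs , shift x ys zs

↭-interpolate : ∀ X {U S Y : Ctx} → (U ++ S) ↭ (X ++ Y) →
  ∃₂ λ ux uy → ∃₂ λ sx sy →
    (U ↭ (ux ++ uy)) × (S ↭ (sx ++ sy)) × (X ↭ (ux ++ sx)) × (Y ↭ (uy ++ sy))
↭-interpolate [] {U} {S} p = [] , U , [] , S , ↭-refl , ↭-refl , ↭-refl , ↭-sym p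
↭-interpolate (z ∷ X) {U} {S} p with ∈-++⁻ U (∈-resp-↭ (↭-sym p) (here refl))
... | inj₁ m with ∈⇒↭∷ m
...   | U' , q with ↭-interpolate X (drop-∷ (↭-trans (↭-sym (++⁺ʳ S q)) p))
...     | ux , uy , sx , sy , eu , es , ex , ey =
          z ∷ ux , uy , sx , sy , ↭-trans q (prep z eu) , es , prep z ex , ey
↭-interpolate (z ∷ X) {U} {S} p | inj₂ m with ∈⇒↭∷ m
...   | S' , q with ↭-interpolate X {U} {S'}
                      (drop-∷ (↭-trans (↭-sym (↭-trans (++⁺ˡ U q) (shift z U S'))) p))
...     | ux , uy , sx , sy , eu , es , ex , ey =
          ux , uy , z ∷ sx , sy , eu , ↭-trans q (prep z es) ,
          ↭-trans (prep z ex) (↭-sym (shift z ux sx)) , ey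

tag : Formula → ℕ
tag (atom _) = 0
tag 𝟏        = 1
tag (_ ⊗ _)  = 2
tag ⊤'       = 3
tag (_ & _)  = 4
tag (_ ⊸ _)  = 5
tag (! _)    = 6

_≟F_ : DecidableEquality Formula

-- The off-diagonal cases are absurd, tag A ≡ tag B being false there.
≟F-sameTag : ∀ A B → tag A ≡ tag B → Dec (A ≡ B)
≟F-sameTag (atom a) (atom b) _ = map′ (≡-cong atom) (λ { refl → refl }) (a ℕ.≟ b)
≟F-sameTag 𝟏 𝟏 _ = yes refl
≟F-sameTag (A ⊗ B) (C ⊗ D) _ =
  map′ (uncurry (cong₂ _⊗_)) (λ { refl → refl , refl }) (A ≟F C ×-dec B ≟F D)
≟F-sameTag ⊤' ⊤' _ = yes refl
≟F-sameTag (A & B) (C & D) _ =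
  map′ (uncurry (cong₂ _&_)) (λ { refl → refl , refl }) (A ≟F C ×-dec B ≟F D)
≟F-sameTag (a ⊸ B) (b ⊸ D) _ =
  map′ (uncurry (cong₂ _⊸_)) (λ { refl → refl , refl }) (a ℕ.≟ b ×-dec B ≟F D)
≟F-sameTag (! A) (! C) _ = map′ (≡-cong !_) (λ { refl → refl }) (A ≟F C)

A ≟F B with tag A ℕ.≟ tag B
... | yes same = ≟F-sameTag A B same
... | no differ = no (differ ∘ ≡-cong tag)

open import Data.List.Membership.DecPropositional _≟F_ using (_∈?_)

_∩_ : Ctx → Ctx → Ctx
Γ ∩ Γ' = filter (_∈? Γ') Γ

∈-∩⁺ : ∀ {x Γ Γ'} → x ∈ Γ → x ∈ Γ' → x ∈ (Γ ∩ Γ')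
∈-∩⁺ {Γ' = Γ'} = ∈-filter⁺ (_∈? Γ')

∩-⊆ˡ : ∀ {Γ Γ'} → (Γ ∩ Γ') ⊆ Γ
∩-⊆ˡ {Γ} {Γ'} m = proj₁ (∈-filter⁻ (_∈? Γ') {xs = Γ} m)

∩-⊆ʳ : ∀ {Γ Γ'} → (Γ ∩ Γ') ⊆ Γ'
∩-⊆ʳ {Γ} {Γ'} m = proj₂ (∈-filter⁻ (_∈? Γ') {xs = Γ} m)

∩-partitionˡ : ∀ {Z} A B → Z ⊆ (A ++ B) → Z ≈Set ((A ∩ Z) ++ (B ∩ Z))
∩-partitionˡ A B s =
  ≈Set-intro (λ m → [ (λ m' → ∈-++⁺ˡ (∈-∩⁺ m' m)) , (λ m' → ∈-++⁺ʳ (A ∩ _) (∈-∩⁺ m' m)) ]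
                        (∈-++⁻ A (s m)))
             (++-⊆ (∩-⊆ʳ {A}) (∩-⊆ʳ {B}))

∩-partitionʳ : ∀ {Z} A B → Z ⊆ (A ++ B) → Z ≈Set ((Z ∩ A) ++ (Z ∩ B))
∩-partitionʳ {Z} A B s =
  ≈Set-intro (λ m → [ (λ m' → ∈-++⁺ˡ (∈-∩⁺ m m')) , (λ m' → ∈-++⁺ʳ (Z ∩ A) (∈-∩⁺ m m')) ]
                        (∈-++⁻ A (s m)))
             (++-⊆ (∩-⊆ˡ {Z}) (∩-⊆ˡ {Z}))

⊕-interpolate : ∀ U S X Y → (U ⊕ S) ≅ (X ⊕ Y) →
  ∃₂ λ Ux Uy → ∃₂ λ Sx Sy →
    (U ≅ (Ux ⊕ Uy)) × (S ≅ (Sx ⊕ Sy)) × (X ≅ (Ux ⊕ Sx)) × (Y ≅ (Uy ⊕ Sy))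
⊕-interpolate (Γu , Δu) (Γs , Δs) (Γx , Δx) (Γy , Δy) ((p , q) , e)
  with ↭-interpolate Δx e
... | ux , uy , sx , sy , eu , es , ex , ey =
  (Γx ∩ Γu , ux) , (Γy ∩ Γu , uy) , (Γx ∩ Γs , sx) , (Γy ∩ Γs , sy) ,
  (∩-partitionˡ Γx Γy (λ m → p _ (∈-++⁺ˡ m)) , eu) ,
  (∩-partitionˡ Γx Γy (λ m → p _ (∈-++⁺ʳ Γu m)) , es) ,
  (∩-partitionʳ Γu Γs (λ m → q _ (∈-++⁺ˡ m)) , ex) ,
  (∩-partitionʳ Γu Γs (λ m → q _ (∈-++⁺ʳ Γx m)) , ey)

⟨_⟩ : Formula → State
⟨ A ⟩ = [] , A ∷ []

⊕-locate : ∀ {x Z} U S → (⟨ x ⟩ ⊕ Z) ≅ (U ⊕ S) →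
  (∃ λ U₀ → (U ≅ (⟨ x ⟩ ⊕ U₀)) × (Z ≅ (U₀ ⊕ S))) ⊎
  (∃ λ S₀ → (S ≅ (⟨ x ⟩ ⊕ S₀)) × (Z ≅ (U ⊕ S₀)))
⊕-locate {x} (Γu , Δu) (Γs , Δs) (Γe , e) with ∈-++⁻ Δu (∈-resp-↭ e (here refl))
... | inj₁ m with ∈⇒↭∷ m
...   | Δu₀ , r =
  inj₁ ((Γu , Δu₀) , (≈Set-refl , r) , (Γe , drop-∷ (↭-trans e (++⁺ʳ Δs r))))
⊕-locate {x} (Γu , Δu) (Γs , Δs) (Γe , e) | inj₂ m with ∈⇒↭∷ m
...   | Δs₀ , r =
  inj₂ ((Γs , Δs₀) , (≈Set-refl , r) ,
        (Γe , drop-∷ (↭-trans e (↭-trans (++⁺ˡ Δu r) (shift x Δu Δs₀)))))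

-- Derivations

_⊢ₛ_ : State → Formula → Set
(Γ , Δ) ⊢ₛ C = Γ ⨾ Δ ⊢ C

clone∈ : ∀ {Γ Δ A C} → A ∈ Γ → Γ ⨾ A ∷ Δ ⊢ C → Γ ⨾ Δ ⊢ C
clone∈ m d with ∈⇒↭∷ m
... | _ , p = exch (↭-sym p) ↭-refl (clone (exch p ↭-refl d))

⊢-weaken : ∀ {Γ Γ' Δ C} → Γ ⊆ Γ' → Γ ⨾ Δ ⊢ C → Γ' ⨾ Δ ⊢ C
⊢-weaken s (exch p q d) = exch ↭-refl q (⊢-weaken (s ∘ ∈-resp-↭ p) d)
⊢-weaken s init         = init
⊢-weaken s (clone d)    = clone∈ (s (here refl)) (⊢-weaken s d)
⊢-weaken s (⊗R d e)     = ⊗R (⊢-weaken s d) (⊢-weaken s e)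
⊢-weaken s (⊗L d)       = ⊗L (⊢-weaken s d)
⊢-weaken s 𝟏R           = 𝟏R
⊢-weaken s (𝟏L d)       = 𝟏L (⊢-weaken s d)
⊢-weaken s (&R d e)     = &R (⊢-weaken s d) (⊢-weaken s e)
⊢-weaken s (&L₁ d)      = &L₁ (⊢-weaken s d)
⊢-weaken s (&L₂ d)      = &L₂ (⊢-weaken s d)
⊢-weaken s ⊤R           = ⊤R
⊢-weaken s (⊸R d)       = ⊸R (⊢-weaken s d)
⊢-weaken s (⊸L d e)     = ⊸L (⊢-weaken s d) (⊢-weaken s e)
⊢-weaken s (!R d)       = !R (⊢-weaken s d)
⊢-weaken s (!L d)       = !L (⊢-weaken (∈-∷⁺ʳ (here refl) (there ∘ s)) d)

⊢-resp-≅ : ∀ {S T C} → S ≅ T → S ⊢ₛ C → T ⊢ₛ C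
⊢-resp-≅ ((p , _) , r) d = exch ↭-refl r (⊢-weaken (p _) d)

-- Transitions and weak τ-runs

frameʳ : ∀ {S T l} U → S -[ l ]→ T → (S ⊕ U) -[ l ]→ (T ⊕ U)
frameʳ U (cong e t e') = cong (⊕-congˡ U e) (frameʳ U t) (⊕-congˡ U e')
frameʳ U out = out
frameʳ U inp = inp
frameʳ U (com {S₁} {S₁'} {S₂} {S₂'} t₁ t₂) =
  cong (⊕-assoc S₁ S₂ U) (com t₁ (frameʳ U t₂)) (≅-sym (⊕-assoc S₁' S₂' U))
frameʳ U ten = ten
frameʳ U one = one
frameʳ U with₁ = with₁
frameʳ U with₂ = with₂
frameʳ U bang = bang
frameʳ U (copy m) = copy (∈-++⁺ˡ m)

frameˡ : ∀ {S T l} U → S -[ l ]→ T → (U ⊕ S) -[ l ]→ (U ⊕ T)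
frameˡ {S} {T} U t = cong (⊕-comm U S) (frameʳ U t) (⊕-comm T U)

snd-inv : ∀ {S T a} → S -[ snd a ]→ T → S ≅ (⟨ atom a ⟩ ⊕ T)
snd-inv {a = a} (cong e t e') = ≅-trans e (≅-trans (snd-inv t) (⊕-congʳ ⟨ atom a ⟩ e'))
snd-inv out = ≅-refl

rcv-inv : ∀ {S T a} → S -[ rcv a ]→ T →
  ∃₂ λ B Z → (S ≅ (⟨ a ⊸ B ⟩ ⊕ Z)) × (T ≅ (⟨ B ⟩ ⊕ Z))
rcv-inv (cong e t e') with rcv-inv t
... | B , Z , p , q = B , Z , ≅-trans e p , ≅-trans (≅-sym e') q
rcv-inv (inp {Γ} {Δ} {B = B}) = B , (Γ , Δ) , ≅-refl , ≅-refl

data Decomposes : Formula → State → Set where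
  dec-⊗  : ∀ {A B} → Decomposes (A ⊗ B) ([] , A ∷ B ∷ [])
  dec-𝟏  : Decomposes 𝟏 ([] , [])
  dec-&₁ : ∀ {A B} → Decomposes (A & B) ⟨ A ⟩
  dec-&₂ : ∀ {A B} → Decomposes (A & B) ⟨ B ⟩
  dec-!  : ∀ {A} → Decomposes (! A) (A ∷ [] , [])

data _↝_ : State → State → Set where
  decompose   : ∀ {A P Z} → Decomposes A P → (⟨ A ⟩ ⊕ Z) ↝ (P ⊕ Z)
  duplicate   : ∀ {A Z} → A ∈ proj₁ Z → Z ↝ (⟨ A ⟩ ⊕ Z)
  communicate : ∀ {a B Z} → (⟨ atom a ⟩ ⊕ (⟨ a ⊸ B ⟩ ⊕ Z)) ↝ (⟨ B ⟩ ⊕ Z)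

Decomposes⇒τ : ∀ {A P} → Decomposes A P → ⟨ A ⟩ -[ τ ]→ P
Decomposes⇒τ dec-⊗  = ten
Decomposes⇒τ dec-𝟏  = one
Decomposes⇒τ dec-&₁ = with₁
Decomposes⇒τ dec-&₂ = with₂
Decomposes⇒τ dec-!  = bang

↝⇒τ : ∀ {S T} → S ↝ T → S -[ τ ]→ T
↝⇒τ (decompose {Z = Z} d) = frameʳ Z (Decomposes⇒τ d)
↝⇒τ (duplicate m) = copy m
↝⇒τ (communicate {a} {B} {Z}) = com {S₁ = ⟨ atom a ⟩} {S₂ = ⟨ a ⊸ B ⟩ ⊕ Z} out inp

τ⇒↝ : ∀ {S T} → S -[ τ ]→ T → ∃₂ λ S' T' → (S ≅ S') × (S' ↝ T') × (T' ≅ T)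
τ⇒↝ (cong e t e') with τ⇒↝ t
... | S' , T' , p , r , q = S' , T' , ≅-trans e p , r , ≅-trans q e'
τ⇒↝ (com {S₁' = S₁'} {a = a} t₁ t₂) with rcv-inv t₂
... | B , Z , p , q =
  ⟨ atom a ⟩ ⊕ (⟨ a ⊸ B ⟩ ⊕ (S₁' ⊕ Z)) , ⟨ B ⟩ ⊕ (S₁' ⊕ Z) ,
  ≅-trans (⊕-cong (snd-inv t₁) p)
    (≅-trans (⊕-assoc ⟨ atom a ⟩ S₁' (⟨ a ⊸ B ⟩ ⊕ Z))
      (⊕-congʳ ⟨ atom a ⟩ (⊕-lcomm S₁' ⟨ a ⊸ B ⟩ Z))) ,
  communicate ,
  ≅-trans (⊕-lcomm ⟨ B ⟩ S₁' Z) (⊕-congʳ S₁' (≅-sym q))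
τ⇒↝ ten      = _ , _ , ≅-refl , decompose dec-⊗ , ≅-refl
τ⇒↝ one      = _ , _ , ≅-refl , decompose dec-𝟏 , ≅-refl
τ⇒↝ with₁    = _ , _ , ≅-refl , decompose dec-&₁ , ≅-refl
τ⇒↝ with₂    = _ , _ , ≅-refl , decompose dec-&₂ , ≅-refl
τ⇒↝ bang     = _ , _ , ≅-refl , decompose dec-! , ≅-refl
τ⇒↝ (copy m) = _ , _ , ≅-refl , duplicate m , ≅-refl

run-≅ : ∀ {S T} → S ≅ T → S ⟹τ T
run-≅ {S} e = S , ε , e

run-id : ∀ {S} → S ⟹τ S
run-id = run-≅ ≅-refl

run-step : ∀ {S T} → S -[ τ ]→ T → S ⟹τ T
run-step {T = T} t = T , t ◅ ε , ≅-refl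

run-≅ˡ : ∀ {S S' T} → S ≅ S' → S' ⟹τ T → S ⟹τ T
run-≅ˡ e (U , ε , e') = run-≅ (≅-trans e e')
run-≅ˡ e (U , t ◅ ts , e') = U , cong e t ≅-refl ◅ ts , e'

run-≅ʳ : ∀ {S T T'} → S ⟹τ T → T ≅ T' → S ⟹τ T'
run-≅ʳ (U , ts , e) e' = U , ts , ≅-trans e e'

run-trans : ∀ {S T V} → S ⟹τ T → T ⟹τ V → S ⟹τ V
run-trans (U , ts , e) r with run-≅ˡ e r
... | W , ts' , e' = W , ts ◅◅ ts' , e'

run-frameʳ : ∀ {S T} U → S ⟹τ T → (S ⊕ U) ⟹τ (T ⊕ U)
run-frameʳ U (V , ts , e) = V ⊕ U , frame* ts , ⊕-congˡ U e
  where
  frame* : ∀ {S T} → Star _-τ→_ S T → Star _-τ→_ (S ⊕ U) (T ⊕ U)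
  frame* ε = ε
  frame* (t ◅ ts) = frameʳ U t ◅ frame* ts

run-frameˡ : ∀ {S T} U → S ⟹τ T → (U ⊕ S) ⟹τ (U ⊕ T)
run-frameˡ {S} {T} U r = run-≅ˡ (⊕-comm U S) (run-≅ʳ (run-frameʳ U r) (⊕-comm T U))

run-par : ∀ {S S' T T'} → S ⟹τ T → S' ⟹τ T' → (S ⊕ S') ⟹τ (T ⊕ T')
run-par {S' = S'} {T} r r' = run-trans (run-frameʳ S' r) (run-frameˡ T r')

⊢-backward : ∀ {S T C} → S ⟹τ T → T ⊢ₛ C → S ⊢ₛ C
⊢-backward (_ , ts , e) d = backward* ts (⊢-resp-≅ (≅-sym e) d)
  where
  backward-↝ : ∀ {S T C} → S ↝ T → T ⊢ₛ C → S ⊢ₛ C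
  backward-↝ (decompose dec-⊗)  d = ⊗L d
  backward-↝ (decompose dec-𝟏)  d = 𝟏L d
  backward-↝ (decompose dec-&₁) d = &L₁ d
  backward-↝ (decompose dec-&₂) d = &L₂ d
  backward-↝ (decompose dec-!)  d = !L d
  backward-↝ (duplicate m)      d = clone∈ m d
  backward-↝ communicate        d = exch ↭-refl (Perm.swap _ _ ↭-refl) (⊸L init d)

  backward* : ∀ {S T C} → Star _-τ→_ S T → T ⊢ₛ C → S ⊢ₛ C
  backward* ε d = d
  backward* (t ◅ ts) d with τ⇒↝ t
  ... | _ , _ , e , r , e' =
    ⊢-resp-≅ (≅-sym e) (backward-↝ r (⊢-resp-≅ (≅-sym e') (backward* ts d)))

-- Satisfaction

infix 4 _⊩_

_⊩_ : State → Formula → Set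
S ⊩ atom a  = ∃ λ G → S ⟹τ (G , atom a ∷ [])
S ⊩ 𝟏       = ∃ λ G → S ⟹τ (G , [])
S ⊩ (A ⊗ B) = ∃₂ λ S₁ S₂ → (S ⟹τ (S₁ ⊕ S₂)) × (S₁ ⊩ A) × (S₂ ⊩ B)
S ⊩ ⊤'      = ⊤
S ⊩ (A & B) = (S ⊩ A) × (S ⊩ B)
S ⊩ (a ⊸ B) = (⟨ atom a ⟩ ⊕ S) ⊩ B
S ⊩ (! A)   = ∃ λ G → (S ⟹τ (G , [])) × ((G , []) ⊩ A)

⊩-backward : ∀ C {S T} → S ⟹τ T → T ⊩ C → S ⊩ C
⊩-backward (atom a) r (G , r')             = G , run-trans r r'
⊩-backward 𝟏        r (G , r')             = G , run-trans r r'
⊩-backward (A ⊗ B)  r (S₁ , S₂ , r' , x , y) = S₁ , S₂ , run-trans r r' , x , y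
⊩-backward ⊤'       r _                    = tt
⊩-backward (A & B)  r (x , y)              = ⊩-backward A r x , ⊩-backward B r y
⊩-backward (a ⊸ B)  r x                    = ⊩-backward B (run-frameˡ ⟨ atom a ⟩ r) x
⊩-backward (! A)    r (G , r' , x)         = G , run-trans r r' , x

⊩-resp-≅ : ∀ C {S T} → S ≅ T → S ⊩ C → T ⊩ C
⊩-resp-≅ C e = ⊩-backward C (run-≅ (≅-sym e))

⊩-persistent : ∀ C G {S} → S ⊩ C → ((G , []) ⊕ S) ⊩ C
⊩-persistent (atom a) G (G' , r) = G ++ G' , run-frameˡ (G , []) r
⊩-persistent 𝟏        G (G' , r) = G ++ G' , run-frameˡ (G , []) r
⊩-persistent (A ⊗ B)  G (S₁ , S₂ , r , x , y) =
  (G , []) ⊕ S₁ , (G , []) ⊕ S₂ ,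
  run-≅ʳ (run-frameˡ (G , []) r) (⊕-distrib-persistent G S₁ S₂) ,
  ⊩-persistent A G x , ⊩-persistent B G y
⊩-persistent ⊤'       G _       = tt
⊩-persistent (A & B)  G (x , y) = ⊩-persistent A G x , ⊩-persistent B G y
⊩-persistent (a ⊸ B)  G {S} x   =
  ⊩-resp-≅ B (⊕-lcomm (G , []) ⟨ atom a ⟩ S) (⊩-persistent B G x)
⊩-persistent (! A)    G (G' , r , x) =
  G ++ G' , run-frameˡ (G , []) r , ⊩-persistent A G x

⊩-weaken : ∀ C {Γ Γ' Δ} → Γ ⊆ Γ' → (Γ , Δ) ⊩ C → (Γ' , Δ) ⊩ C
⊩-weaken C {Γ' = Γ'} {Δ} s x = ⊩-resp-≅ C (≅-sym (≅-absorb Δ s)) (⊩-persistent C Γ' x)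

⊩-axiom : ∀ A Γ → (Γ , A ∷ []) ⊩ A
⊩-axiom (atom a) Γ = Γ , run-id
⊩-axiom 𝟏        Γ = Γ , run-step one
⊩-axiom (A ⊗ B)  Γ =
  (Γ , A ∷ []) , (Γ , B ∷ []) , run-trans (run-step ten) (run-≅ (≅-share Γ (A ∷ []) (B ∷ []))) ,
  ⊩-axiom A Γ , ⊩-axiom B Γ
⊩-axiom ⊤'       Γ = tt
⊩-axiom (A & B)  Γ =
  ⊩-backward A (run-step with₁) (⊩-axiom A Γ) , ⊩-backward B (run-step with₂) (⊩-axiom B Γ)
⊩-axiom (a ⊸ B)  Γ = ⊩-backward B (run-step (↝⇒τ (communicate {Z = Γ , []}))) (⊩-axiom B Γ)
⊩-axiom (! A)    Γ =
  A ∷ Γ , run-step bang , ⊩-backward A (run-step (copy (here refl))) (⊩-axiom A (A ∷ Γ))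

⊢⇒⊩ : ∀ {Γ Δ C} → Γ ⨾ Δ ⊢ C → (Γ , Δ) ⊩ C
⊢⇒⊩ {C = C} (exch p q d) =
  ⊩-resp-≅ C (≈Set-intro (∈-resp-↭ p) (∈-resp-↭ (↭-sym p)) , q) (⊢⇒⊩ d)
⊢⇒⊩ {Γ} init            = Γ , run-id
⊢⇒⊩ {C = C} (clone d)   = ⊩-backward C (run-step (copy (here refl))) (⊢⇒⊩ d)
⊢⇒⊩ (⊗R {Γ} {Δ₁} {Δ₂} d e) = _ , _ , run-≅ (≅-share Γ Δ₁ Δ₂) , ⊢⇒⊩ d , ⊢⇒⊩ e
⊢⇒⊩ {C = C} (⊗L d)      = ⊩-backward C (run-step ten) (⊢⇒⊩ d)
⊢⇒⊩ {Γ} 𝟏R              = Γ , run-id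
⊢⇒⊩ {C = C} (𝟏L d)      = ⊩-backward C (run-step one) (⊢⇒⊩ d)
⊢⇒⊩ (&R d e)            = ⊢⇒⊩ d , ⊢⇒⊩ e
⊢⇒⊩ {C = C} (&L₁ d)     = ⊩-backward C (run-step with₁) (⊢⇒⊩ d)
⊢⇒⊩ {C = C} (&L₂ d)     = ⊩-backward C (run-step with₂) (⊢⇒⊩ d)
⊢⇒⊩ ⊤R                  = tt
⊢⇒⊩ (⊸R d)              = ⊢⇒⊩ d
⊢⇒⊩ (⊸L {Γ} {Δ₁} {Δ₂} {a} {B} {C} d e) with ⊢⇒⊩ d
... | G , r = ⊩-backward C run (⊩-persistent C G (⊢⇒⊩ e))
  where
  -- Δ₁ first produces the atom a, which is then consumed by a ⊸ B.
  run : (Γ , (a ⊸ B) ∷ Δ₁ ++ Δ₂) ⟹τ ((G , []) ⊕ (Γ , B ∷ Δ₂))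
  run = run-≅ˡ (≈Set-intro (xs⊆xs++ys Γ Γ) (++-⊆ ⊆-refl ⊆-refl) , ↭-sym (shift (a ⊸ B) Δ₁ Δ₂))
          (run-trans (run-frameʳ (Γ , (a ⊸ B) ∷ Δ₂) r)
            (run-step (↝⇒τ (communicate {Z = G ++ Γ , Δ₂}))))
⊢⇒⊩ {Γ} (!R d)          = Γ , run-id , ⊢⇒⊩ d
⊢⇒⊩ {C = C} (!L d)      = ⊩-backward C (run-step bang) (⊢⇒⊩ d)

⊩⇒⊢ : ∀ C {S} → S ⊩ C → S ⊢ₛ C
⊩⇒⊢ (atom a) (_ , r)                 = ⊢-backward r init
⊩⇒⊢ 𝟏        (_ , r)                 = ⊢-backward r 𝟏R
⊩⇒⊢ (A ⊗ B)  ((Γ₁ , _) , (Γ₂ , _) , r , x , y) =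
  ⊢-backward r (⊗R (⊢-weaken (xs⊆xs++ys Γ₁ Γ₂) (⊩⇒⊢ A x))
                   (⊢-weaken (xs⊆ys++xs Γ₂ Γ₁) (⊩⇒⊢ B y)))
⊩⇒⊢ ⊤'       _                       = ⊤R
⊩⇒⊢ (A & B)  (x , y)                 = &R (⊩⇒⊢ A x) (⊩⇒⊢ B y)
⊩⇒⊢ (a ⊸ B)  x                       = ⊸R (⊩⇒⊢ B x)
⊩⇒⊢ (! A)    (_ , r , x)             = ⊢-backward r (!R (⊩⇒⊢ A x))

-- Characteristic formulas

⋀ : Ctx → Formula
⋀ []      = ⊤'
⋀ (A ∷ Γ) = A & ⋀ Γ

⨂ : Ctx → Formula
⨂ []      = 𝟏
⨂ (A ∷ Δ) = A ⊗ ⨂ Δ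

χ : State → Formula
χ (Γ , Δ) = (! ⋀ Γ) ⊗ ⨂ Δ

infix 4 _⊩*_

_⊩*_ : State → Ctx → Set
S ⊩* Γ = ∀ {A} → A ∈ Γ → S ⊩ A

⊩⋀⇒⊩* : ∀ Γ {S} → S ⊩ ⋀ Γ → S ⊩* Γ
⊩⋀⇒⊩* (B ∷ Γ) (x , _) (here refl) = x
⊩⋀⇒⊩* (B ∷ Γ) (_ , y) (there m)   = ⊩⋀⇒⊩* Γ y m

⊩*⇒⊩⋀ : ∀ Γ {S} → S ⊩* Γ → S ⊩ ⋀ Γ
⊩*⇒⊩⋀ []      _  = tt
⊩*⇒⊩⋀ (B ∷ Γ) xs = xs (here refl) , ⊩*⇒⊩⋀ Γ (xs ∘ there)

⊩⨂-resp-↭ : ∀ {Δ Δ' S} → Δ ↭ Δ' → S ⊩ ⨂ Δ → S ⊩ ⨂ Δ'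
⊩⨂-resp-↭ Perm.refl x = x
⊩⨂-resp-↭ (Perm.prep A p) (S₁ , S₂ , r , a , b) = S₁ , S₂ , r , a , ⊩⨂-resp-↭ p b
⊩⨂-resp-↭ (Perm.swap A B p) (S₁ , S₂ , r , a , (S₃ , S₄ , r' , b , c)) =
  S₃ , S₁ ⊕ S₄ , run-trans r (run-≅ʳ (run-frameˡ S₁ r') (⊕-lcomm S₁ S₃ S₄)) ,
  b , (S₁ , S₄ , run-id , a , ⊩⨂-resp-↭ p c)
⊩⨂-resp-↭ (Perm.trans p q) x = ⊩⨂-resp-↭ q (⊩⨂-resp-↭ p x)

⊩⨂-++⁻ : ∀ Δ₁ {Δ₂ S} → S ⊩ ⨂ (Δ₁ ++ Δ₂) →
  ∃₂ λ S₁ S₂ → (S ⟹τ (S₁ ⊕ S₂)) × (S₁ ⊩ ⨂ Δ₁) × (S₂ ⊩ ⨂ Δ₂)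
⊩⨂-++⁻ [] x = ([] , []) , _ , run-id , ([] , run-id) , x
⊩⨂-++⁻ (A ∷ Δ₁) (S₁ , S₂ , r , a , b) with ⊩⨂-++⁻ Δ₁ b
... | X , Y , r' , x , y =
  S₁ ⊕ X , Y , run-trans r (run-≅ʳ (run-frameˡ S₁ r') (≅-sym (⊕-assoc S₁ X Y))) ,
  (S₁ , X , run-id , a , x) , y

⊩⨂-self : ∀ Γ Δ → (Γ , Δ) ⊩ ⨂ Δ
⊩⨂-self Γ []      = Γ , run-id
⊩⨂-self Γ (A ∷ Δ) = _ , _ , run-≅ (≅-share Γ (A ∷ []) Δ) , ⊩-axiom A Γ , ⊩⨂-self Γ Δ

-- T ⊩ χ S, with the two runs of its ⊗ and ! merged into one.
_≼χ_ : State → State → Set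
(Γ , Δ) ≼χ T = ∃₂ λ G T₁ → (T ⟹τ ((G , []) ⊕ T₁)) × ((G , []) ⊩* Γ) × (T₁ ⊩ ⨂ Δ)

⊩χ⇒≼χ : ∀ S {T} → T ⊩ χ S → S ≼χ T
⊩χ⇒≼χ (Γ , Δ) (S₁ , S₂ , r , (G , r₁ , x) , y) =
  G , S₂ , run-trans r (run-frameʳ S₂ r₁) , ⊩⋀⇒⊩* Γ x , y

≼χ⇒⊩χ : ∀ S {T} → S ≼χ T → T ⊩ χ S
≼χ⇒⊩χ (Γ , Δ) (G , T₁ , r , xs , y) = (G , []) , T₁ , r , (G , run-id , ⊩*⇒⊩⋀ Γ xs) , y

≼χ-refl : ∀ S → S ≼χ S
≼χ-refl (Γ , Δ) =
  Γ , (Γ , Δ) , run-≅ (≅-share Γ [] Δ) ,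
  (λ {A} m → ⊩-backward A (run-step (copy m)) (⊩-axiom A Γ)) , ⊩⨂-self Γ Δ

≼χ-respˡ : ∀ {S S' T} → S ≅ S' → S ≼χ T → S' ≼χ T
≼χ-respˡ {_ , _} {_ , _} ((_ , q) , e) (G , T₁ , r , xs , y) =
  G , T₁ , r , xs ∘ q _ , ⊩⨂-resp-↭ e y

≼χ-backward : ∀ S {T T'} → T ⟹τ T' → S ≼χ T' → S ≼χ T
≼χ-backward (_ , _) r (G , T₁ , r' , xs , y) = G , T₁ , run-trans r r' , xs , y

≼χ-↝ : ∀ {X Y T} → X ↝ Y → X ≼χ T → Y ≼χ T
≼χ-↝ (decompose dec-⊗) (G , T₁ , r , xs , (S₁ , S₂ , r₁ , (P₁ , P₂ , r₂ , a , b) , c)) =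
  G , T₁ , r , xs ,
  (P₁ , P₂ ⊕ S₂ , run-trans r₁ (run-≅ʳ (run-frameʳ S₂ r₂) (⊕-assoc P₁ P₂ S₂)) ,
   a , (P₂ , S₂ , run-id , b , c))
≼χ-↝ (decompose {Z = _ , Δ} dec-𝟏) (G , T₁ , r , xs , (S₁ , S₂ , r₁ , (G₁ , r₂) , c)) =
  G , T₁ , r , xs ,
  ⊩-backward (⨂ Δ) (run-trans r₁ (run-frameʳ S₂ r₂)) (⊩-persistent (⨂ Δ) G₁ c)
≼χ-↝ (decompose dec-&₁) (G , T₁ , r , xs , (S₁ , S₂ , r₁ , (a , _) , c)) =
  G , T₁ , r , xs , (S₁ , S₂ , r₁ , a , c)
≼χ-↝ (decompose dec-&₂) (G , T₁ , r , xs , (S₁ , S₂ , r₁ , (_ , b) , c)) =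
  G , T₁ , r , xs , (S₁ , S₂ , r₁ , b , c)
≼χ-↝ (decompose {Z = Γ , _} (dec-! {A}))
     (G , T₁ , r , xs , (S₁ , S₂ , r₁ , (G₁ , r₂ , a) , c)) =
  G ++ G₁ , S₂ ,
  run-trans r (run-≅ʳ (run-frameˡ (G , []) (run-trans r₁ (run-frameʳ S₂ r₂)))
                      (≅-sym (⊕-assoc (G , []) (G₁ , []) S₂))) ,
  xs' , c
  where
  xs' : (G ++ G₁ , []) ⊩* (A ∷ Γ)
  xs' (here refl) = ⊩-weaken A (xs⊆ys++xs G₁ G) a
  xs' {B} (there m) = ⊩-weaken B (xs⊆xs++ys G G₁) (xs m)
≼χ-↝ (duplicate m) (G , T₁ , r , xs , c) =
  G , (G , []) ⊕ T₁ ,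
  run-≅ʳ r (≅-trans (⊕-congˡ T₁ (≅-share G [] [])) (⊕-assoc (G , []) (G , []) T₁)) , xs ,
  ((G , []) , T₁ , run-id , xs m , c)
≼χ-↝ (communicate {a} {B})
     (G , T₁ , r , xs , (S₁ , S₂ , r₁ , (G₁ , r₂) , (P₁ , P₂ , r₃ , b , c))) =
  G , T₁ , r , xs ,
  ((G₁ , []) ⊕ (⟨ atom a ⟩ ⊕ P₁) , P₂ ,
   run-trans r₁ (run-≅ʳ (run-par r₂ r₃) (≅-sym (⊕-assoc (G₁ , []) (⟨ atom a ⟩ ⊕ P₁) P₂))) ,
   ⊩-persistent B G₁ b , c)

≼χ-isSimulation : IsSimulation _≼χ_
≼χ-isSimulation = record
  { resp = λ {_} {S'} e e' x → ≼χ-backward S' (run-≅ (≅-sym e')) (≼χ-respˡ e x)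
  ; c1   = c1
  ; c2   = c2
  ; c3τ  = c3τ
  ; c3!  = c3!
  ; c4   = c4
  }
  where
  c1 : ∀ {S T} → S ≼χ T → ∀ Γ → S ≅ (Γ , []) →
       ∃ λ Γ' → T ⟹τ (Γ' , []) × (Γ , []) ≼χ (Γ' , [])
  c1 x Γ e with ≼χ-respˡ e x
  ... | G , T₁ , r , xs , (G₁ , r₁) =
    G ++ G₁ , run-trans r (run-frameˡ (G , []) r₁) ,
    G ++ G₁ , ([] , []) , run-≅ (≅-sym (⊕-identityʳ (G ++ G₁ , []))) ,
    (λ {A} m → ⊩-weaken A (xs⊆xs++ys G G₁) (xs m)) , ([] , run-id)

  c2 : ∀ {S T} → S ≼χ T → ∀ S₁ S₂ → S ≅ (S₁ ⊕ S₂) →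
       ∃₂ λ T₁ T₂ → T ⟹τ (T₁ ⊕ T₂) × S₁ ≼χ T₁ × S₂ ≼χ T₂
  c2 x (Γ₁ , Δ₁) (Γ₂ , Δ₂) e with ≼χ-respˡ e x
  ... | G , T₀ , r , xs , y with ⊩⨂-++⁻ Δ₁ y
  ...   | X , Y , r' , x₁ , y₂ =
    (G , []) ⊕ X , (G , []) ⊕ Y ,
    run-trans r (run-≅ʳ (run-frameˡ (G , []) r') (⊕-distrib-persistent G X Y)) ,
    (G , X , run-id , xs ∘ ∈-++⁺ˡ , x₁) ,
    (G , Y , run-id , xs ∘ ∈-++⁺ʳ Γ₁ , y₂)

  c3τ : ∀ {S T} → S ≼χ T → ∀ S' → S -[ τ ]→ S' → ∃ λ T' → T ⟹τ T' × S' ≼χ T'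
  c3τ {T = T} x S' t with τ⇒↝ t
  ... | _ , _ , e , r , e' = T , run-id , ≼χ-respˡ e' (≼χ-↝ r (≼χ-respˡ e x))

  c3! : ∀ {S T} → S ≼χ T → ∀ a S' → S -[ snd a ]→ S' →
        ∃ λ T' → T ⟹[ snd a ] T' × S' ≼χ T'
  c3! x a (Γ , Δ) t with ≼χ-respˡ (snd-inv t) x
  ... | G , T₁ , r , xs , (S₁ , S₂ , r₁ , (G₁ , r₂) , y) =
    (G , []) ⊕ ((G₁ , []) ⊕ S₂) ,
    (_ , _ , run-trans r (run-frameˡ (G , []) (run-trans r₁ (run-frameʳ S₂ r₂))) ,
     out , run-id) ,
    G , (G₁ , []) ⊕ S₂ , run-id , xs , ⊩-persistent (⨂ Δ) G₁ y

  c4 : ∀ {S T} → S ≼χ T → ∀ a S' → S -[ rcv a ]→ S' →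
       ∃ λ T' → (proj₁ T , atom a ∷ proj₂ T) ⟹τ T' × S' ≼χ T'
  c4 x a S' t with rcv-inv t
  ... | B , Z , e , e' with ≼χ-respˡ e x
  ...   | G , T₁ , r , xs , (S₁ , S₂ , r₁ , b , y) =
    (G , []) ⊕ ((⟨ atom a ⟩ ⊕ S₁) ⊕ S₂) ,
    run-frameˡ ⟨ atom a ⟩ (run-trans r (run-frameˡ (G , []) r₁)) ,
    ≼χ-respˡ (≅-sym e')
      (G , (⟨ atom a ⟩ ⊕ S₁) ⊕ S₂ , run-id , xs , (⟨ atom a ⟩ ⊕ S₁ , S₂ , run-id , b , y))

≼l⇒≼χ : ∀ {S T} → S ≼l T → S ≼χ T
≼l⇒≼χ {S} l =
  ⊩χ⇒≼χ S (⊢⇒⊩ (l [] [] (χ S) (⊩⇒⊢ (χ S) (≼χ⇒⊩χ S (≼χ-refl S)))))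

-- Compositionality of simulations

Framed : (State → State → Set) → State → State → Set
Framed R S T = ∃₂ λ U S₀ → ∃ λ T₀ → (S ≅ (U ⊕ S₀)) × (T ≅ (U ⊕ T₀)) × R S₀ T₀

module _ {R : State → State → Set} (sim : IsSimulation R) where
  open IsSimulation sim

  private
    Matched : State → State → Set
    Matched T Y = ∃ λ T' → T ⟹τ T' × Framed R Y T'

    step-in-frame : ∀ {T U U' S₀ T₀ Y} → T ≅ (U ⊕ T₀) → U -[ τ ]→ U' →
      Y ≅ (U' ⊕ S₀) → R S₀ T₀ → Matched T Y
    step-in-frame {U' = U'} {S₀} {T₀} et t ey rr =
      U' ⊕ T₀ , run-≅ˡ et (run-step (frameʳ T₀ t)) , U' , S₀ , T₀ , ey , ≅-refl , rr

    step-inside : ∀ {T U S₀ S₀' T₀ Y} → T ≅ (U ⊕ T₀) → S₀ -[ τ ]→ S₀' →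
      Y ≅ (U ⊕ S₀') → R S₀ T₀ → Matched T Y
    step-inside {U = U} {S₀' = S₀'} et t ey rr with c3τ rr _ t
    ... | T₁ , r , rr' = U ⊕ T₁ , run-≅ˡ et (run-frameˡ U r) , U , S₀' , T₁ , ey , ≅-refl , rr'

    -- An atom of the frame meeting a ⊸ of S₀ is an input of S₀, and vice versa
    -- an output of S₀ meeting a ⊸ of the frame.
    communicate-framed : ∀ {a B Z T} U S₀ {T₀} →
      (⟨ atom a ⟩ ⊕ (⟨ a ⊸ B ⟩ ⊕ Z)) ≅ (U ⊕ S₀) → T ≅ (U ⊕ T₀) → R S₀ T₀ →
      Matched T (⟨ B ⟩ ⊕ Z)
    communicate-framed {a} {B} {Z} {T} U S₀ {T₀} ex et rr with ⊕-locate U S₀ ex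
    ... | inj₁ (U₁ , eu₁ , ez₁) = atom-in-frame (⊕-locate U₁ S₀ ez₁)
      where
      atom-in-frame : (∃ λ U₂ → (U₁ ≅ (⟨ a ⊸ B ⟩ ⊕ U₂)) × (Z ≅ (U₂ ⊕ S₀))) ⊎
                      (∃ λ S₂ → (S₀ ≅ (⟨ a ⊸ B ⟩ ⊕ S₂)) × (Z ≅ (U₁ ⊕ S₂))) →
                      Matched T (⟨ B ⟩ ⊕ Z)
      atom-in-frame (inj₁ (U₂ , eu₂ , ez₂)) =
        step-in-frame et (cong (≅-trans eu₁ (⊕-congʳ ⟨ atom a ⟩ eu₂)) (↝⇒τ communicate) ≅-refl)
          (⊕-pushˡ ⟨ B ⟩ U₂ S₀ ez₂) rr
      atom-in-frame (inj₂ (S₂ , es₂ , ez₂)) with c4 rr a (⟨ B ⟩ ⊕ S₂) (cong es₂ inp ≅-refl)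
      ... | T₁ , r , rr' =
        U₁ ⊕ T₁ ,
        run-≅ˡ (≅-trans et (≅-trans (⊕-congˡ T₀ eu₁) (⊕-pushʳ ⟨ atom a ⟩ U₁ T₀ ≅-refl)))
          (run-frameˡ U₁ r) ,
        U₁ , ⟨ B ⟩ ⊕ S₂ , T₁ , ⊕-pushʳ ⟨ B ⟩ U₁ S₂ ez₂ , ≅-refl , rr'
    ... | inj₂ (S₁ , es₁ , ez₁) = atom-inside (⊕-locate U S₁ ez₁)
      where
      atom-inside : (∃ λ U₂ → (U ≅ (⟨ a ⊸ B ⟩ ⊕ U₂)) × (Z ≅ (U₂ ⊕ S₁))) ⊎
                    (∃ λ S₂ → (S₁ ≅ (⟨ a ⊸ B ⟩ ⊕ S₂)) × (Z ≅ (U ⊕ S₂))) →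
                    Matched T (⟨ B ⟩ ⊕ Z)
      atom-inside (inj₁ (U₂ , eu₂ , ez₂)) with c3! rr a S₁ (cong es₁ out ≅-refl)
      ... | T₁ , (V₁ , V₂ , r₁ , t , r₂) , rr' =
        (⟨ B ⟩ ⊕ U₂) ⊕ T₁ ,
        run-≅ˡ et (run-trans (run-frameˡ U r₁)
          (run-trans (run-≅ˡ (⊕-comm U V₁) (run-step (com t (cong eu₂ inp ≅-refl))))
            (run-≅ʳ (run-frameʳ (⟨ B ⟩ ⊕ U₂) r₂) (⊕-comm T₁ (⟨ B ⟩ ⊕ U₂))))) ,
        ⟨ B ⟩ ⊕ U₂ , S₁ , T₁ , ⊕-pushˡ ⟨ B ⟩ U₂ S₁ ez₂ , ≅-refl , rr'
      atom-inside (inj₂ (S₂ , es₂ , ez₂)) =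
        step-inside et (cong (≅-trans es₁ (⊕-congʳ ⟨ atom a ⟩ es₂)) (↝⇒τ communicate) ≅-refl)
          (⊕-pushʳ ⟨ B ⟩ U S₂ ez₂) rr

    ↝-framed : ∀ {X Y T} U S₀ {T₀} → X ↝ Y → X ≅ (U ⊕ S₀) → T ≅ (U ⊕ T₀) → R S₀ T₀ →
      Matched T Y
    ↝-framed U S₀ (decompose {P = P} d) ex et rr with ⊕-locate U S₀ ex
    ... | inj₁ (U₀ , eu , ez) =
      step-in-frame et (cong eu (frameʳ U₀ (Decomposes⇒τ d)) ≅-refl) (⊕-pushˡ P U₀ S₀ ez) rr
    ... | inj₂ (S₁ , es , ez) =
      step-inside et (cong es (frameʳ S₁ (Decomposes⇒τ d)) ≅-refl) (⊕-pushʳ P U S₁ ez) rr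
    ↝-framed (Γu , Δu) S₀ (duplicate {A} m) ex et rr with ∈-++⁻ Γu (proj₁ (proj₁ ex) A m)
    ... | inj₁ m' = step-in-frame et (copy m') (⊕-pushˡ ⟨ A ⟩ (Γu , Δu) S₀ ex) rr
    ... | inj₂ m' = step-inside et (copy m') (⊕-pushʳ ⟨ A ⟩ (Γu , Δu) S₀ ex) rr
    ↝-framed U S₀ communicate ex et rr = communicate-framed U S₀ ex et rr

    framed-c1 : ∀ {S T} → Framed R S T → ∀ Γ → S ≅ (Γ , []) →
      ∃ λ Γ' → T ⟹τ (Γ' , []) × Framed R (Γ , []) (Γ' , [])
    framed-c1 ((Γu , Δu) , (Γs , Δs) , T₀ , e₁ , e₂ , rr) Γ e
      with ↭-empty-inv (proj₂ (≅-trans (≅-sym e₁) e))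
    ... | Δu++Δs≡[] with List.++-conicalˡ Δu Δs Δu++Δs≡[] | List.++-conicalʳ Δu Δs Δu++Δs≡[]
    ...   | refl | refl with c1 rr Γs ≅-refl
    ...     | G , r , rr' =
      Γu ++ G , run-≅ˡ e₂ (run-frameˡ (Γu , []) r) ,
      (Γu , []) , (Γs , []) , (G , []) , ≅-trans (≅-sym e) e₁ , ≅-refl , rr'

    framed-c2 : ∀ {S T} → Framed R S T → ∀ X Y → S ≅ (X ⊕ Y) →
      ∃₂ λ T₁ T₂ → T ⟹τ (T₁ ⊕ T₂) × Framed R X T₁ × Framed R Y T₂
    framed-c2 (U , S₀ , T₀ , e₁ , e₂ , rr) X Y e
      with ⊕-interpolate U S₀ X Y (≅-trans (≅-sym e₁) e)
    ... | Ux , Uy , Sx , Sy , eu , es , ex , ey with c2 rr Sx Sy es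
    ...   | Tx , Ty , r , rx , ry =
      Ux ⊕ Tx , Uy ⊕ Ty ,
      run-≅ʳ (run-≅ˡ e₂ (run-frameˡ U r))
        (≅-trans (⊕-congˡ (Tx ⊕ Ty) eu) (⊕-interchange Ux Uy Tx Ty)) ,
      (Ux , Sx , Tx , ex , ≅-refl , rx) , (Uy , Sy , Ty , ey , ≅-refl , ry)

    framed-c3τ : ∀ {S T} → Framed R S T → ∀ S' → S -[ τ ]→ S' → Matched T S'
    framed-c3τ (U , S₀ , T₀ , e₁ , e₂ , rr) S' t with τ⇒↝ t
    ... | _ , _ , e , r , e' with ↝-framed U S₀ r (≅-trans (≅-sym e) e₁) e₂ rr
    ...   | T' , r' , (U' , S₀' , T₀' , f₁ , f₂ , rr') =
      T' , r' , U' , S₀' , T₀' , ≅-trans (≅-sym e') f₁ , f₂ , rr'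

    framed-c3! : ∀ {S T} → Framed R S T → ∀ a S' → S -[ snd a ]→ S' →
      ∃ λ T' → T ⟹[ snd a ] T' × Framed R S' T'
    framed-c3! (U , S₀ , T₀ , e₁ , e₂ , rr) a S' t
      with ⊕-locate U S₀ (≅-trans (≅-sym (snd-inv t)) e₁)
    ... | inj₁ (U₀ , eu , ez) =
      U₀ ⊕ T₀ ,
      (_ , _ , run-id ,
       cong (≅-trans e₂ (≅-trans (⊕-congˡ T₀ eu) (⊕-assoc ⟨ atom a ⟩ U₀ T₀))) out ≅-refl ,
       run-id) ,
      U₀ , S₀ , T₀ , ez , ≅-refl , rr
    ... | inj₂ (S₁ , es , ez) with c3! rr a S₁ (cong es out ≅-refl)
    ...   | T₁ , (V₁ , V₂ , r₁ , t' , r₂) , rr' =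
      U ⊕ T₁ ,
      (_ , _ , run-≅ˡ e₂ (run-frameˡ U r₁) , frameˡ U t' , run-frameˡ U r₂) ,
      U , S₁ , T₁ , ez , ≅-refl , rr'

    framed-c4 : ∀ {S T} → Framed R S T → ∀ a S' → S -[ rcv a ]→ S' →
      ∃ λ T' → (proj₁ T , atom a ∷ proj₂ T) ⟹τ T' × Framed R S' T'
    framed-c4 (U , S₀ , T₀ , e₁ , e₂ , rr) a S' t with rcv-inv t
    ... | B , Z , e , e' with ⊕-locate U S₀ (≅-trans (≅-sym e) e₁)
    ...   | inj₁ (U₀ , eu , ez) =
      step-in-frame (⊕-pushˡ ⟨ atom a ⟩ U T₀ e₂)
        (cong (⊕-congʳ ⟨ atom a ⟩ eu) (↝⇒τ communicate) ≅-refl)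
        (≅-trans e' (⊕-pushˡ ⟨ B ⟩ U₀ S₀ ez)) rr
    ...   | inj₂ (S₁ , es , ez) with c4 rr a (⟨ B ⟩ ⊕ S₁) (cong es inp ≅-refl)
    ...     | T₁ , r , rr' =
      U ⊕ T₁ , run-≅ˡ (⊕-pushʳ ⟨ atom a ⟩ U T₀ e₂) (run-frameˡ U r) ,
      U , ⟨ B ⟩ ⊕ S₁ , T₁ , ≅-trans e' (⊕-pushʳ ⟨ B ⟩ U S₁ ez) , ≅-refl , rr'

  Framed-isSimulation : IsSimulation (Framed R)
  Framed-isSimulation = record
    { resp = λ { e e' (U , S₀ , T₀ , e₁ , e₂ , rr) →
                 U , S₀ , T₀ , ≅-trans (≅-sym e) e₁ , ≅-trans (≅-sym e') e₂ , rr }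
    ; c1 = framed-c1 ; c2 = framed-c2 ; c3τ = framed-c3τ ; c3! = framed-c3! ; c4 = framed-c4 }

-- Simulations preserve satisfaction

simulate-star : ∀ {R} → IsSimulation R → ∀ {S T S'} → R S T → Star _-τ→_ S S' →
  ∃ λ T' → T ⟹τ T' × R S' T'
simulate-star sim {T = T} rel ε = T , run-id , rel
simulate-star sim rel (t ◅ ts) with IsSimulation.c3τ sim rel _ t
... | _ , r₁ , rel₁ with simulate-star sim rel₁ ts
...   | T' , r₂ , rel₂ = T' , run-trans r₁ r₂ , rel₂

simulate-run : ∀ {R} → IsSimulation R → ∀ {S T S'} → R S T → S ⟹τ S' →
  ∃ λ T' → T ⟹τ T' × R S' T'
simulate-run sim rel (_ , ts , e) with simulate-star sim rel ts
... | T' , r , rel' = T' , r , IsSimulation.resp sim e ≅-refl rel'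

-- ⊸ extends the state, which is why the induction runs over all simulations
-- and passes from R to Framed R.
simulation-⊩ : ∀ C {R} → IsSimulation R → ∀ {S T} → R S T → S ⊩ C → T ⊩ C
simulation-⊩ (atom a) sim rel (G , r) with simulate-run sim rel r
... | _ , r₁ , rel₁ with IsSimulation.c3! sim rel₁ a (G , []) out
...   | _ , (_ , _ , r₂ , t , r₃) , rel₂ with IsSimulation.c1 sim rel₂ G ≅-refl
...     | G' , r₄ , _ =
  G' , run-trans r₁ (run-trans r₂ (run-≅ˡ (snd-inv t) (run-frameˡ ⟨ atom a ⟩ (run-trans r₃ r₄))))
simulation-⊩ 𝟏 sim rel (G , r) with simulate-run sim rel r
... | _ , r₁ , rel₁ with IsSimulation.c1 sim rel₁ G ≅-refl
...   | G' , r₂ , _ = G' , run-trans r₁ r₂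
simulation-⊩ (A ⊗ B) sim rel (S₁ , S₂ , r , x , y) with simulate-run sim rel r
... | _ , r₁ , rel₁ with IsSimulation.c2 sim rel₁ S₁ S₂ ≅-refl
...   | T₁ , T₂ , r₂ , rel₂ , rel₃ =
  T₁ , T₂ , run-trans r₁ r₂ , simulation-⊩ A sim rel₂ x , simulation-⊩ B sim rel₃ y
simulation-⊩ ⊤' sim rel _ = tt
simulation-⊩ (A & B) sim rel (x , y) = simulation-⊩ A sim rel x , simulation-⊩ B sim rel y
simulation-⊩ (a ⊸ B) sim {S} {T} rel x =
  simulation-⊩ B (Framed-isSimulation sim) (⟨ atom a ⟩ , S , T , ≅-refl , ≅-refl , rel) x
simulation-⊩ (! A) sim rel (G , r , x) with simulate-run sim rel r
... | _ , r₁ , rel₁ with IsSimulation.c1 sim rel₁ G ≅-refl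
...   | G' , r₂ , rel₂ = G' , run-trans r₁ r₂ , simulation-⊩ A sim rel₂ x

≼s⇒≼l : ∀ {S T} → S ≼s T → S ≼l T
≼s⇒≼l {S} {T} (R , sim , rel) Γ' Δ' C d =
  ⊩⇒⊢ C (simulation-⊩ C (Framed-isSimulation sim)
           ((Γ' , Δ') , S , T , ≅-refl , ≅-refl , rel) (⊢⇒⊩ d))

theorem5 : ∀ Γ₁ Δ₁ Γ₂ Δ₂ → Unique Γ₁ → Unique Γ₂ →
    (((Γ₁ , Δ₁) ≼l (Γ₂ , Δ₂)) → ((Γ₁ , Δ₁) ≼s (Γ₂ , Δ₂))) ×
    (((Γ₁ , Δ₁) ≼s (Γ₂ , Δ₂)) → ((Γ₁ , Δ₁) ≼l (Γ₂ , Δ₂)))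
theorem5 _ _ _ _ _ _ = (λ l → _≼χ_ , ≼χ-isSimulation , ≼l⇒≼χ l) , ≼s⇒≼l
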